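{- Let $n=2k+1$ be an odd integer greater than $1$. Then the checkerboard graph $G_{4,n}$ admits no matchless graph derangement having $2k-1$ or more cycles of length $4$.
   Context: For positive integers $m,n$, $G_{m,n}$ denotes the checkerboard graph (also written $R_{m,n}$): vertex set $\{1,\dots,m\}\times\{1,\dots,n\}$, with $(x_1,x_2)$ adjacent to $(y_1,y_2)$ iff $|x_1-y_1|+|x_2-y_2|=1$. A graph derangement of a graph $G=(V,E)$ is an injective map $f:V\to V$ with $f(v)$ adjacent to $v$ for all $v$. For a finite graph, the cycles of $f$ are its orbits, and the length of a cycle is its number of elements. A graph derangement is matchless if it has no cycles of length $2$. -}

module Defs where

open import Data.Nat using (ℕ; zero; suc; _+_; _<_; ∣_-_∣)
open import Data.Fin using (Fin; toℕ)
open import Data.Product using (_×_; _,_; ∃)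
open import Relation.Binary.PropositionalEquality using (_≡_; _≢_)
open import Relation.Nullary using (¬_)
open import Function.Definitions using (Injective)

-- vertices of the checkerboard graph G_{m,n}: {1..m}×{1..n}, 0-indexed via Fin
Vertex : ℕ → ℕ → Set
Vertex m n = Fin m × Fin n

Adjacent : ∀ {m n} → Vertex m n → Vertex m n → Set
Adjacent (x₁ , x₂) (y₁ , y₂) = ∣ toℕ x₁ - toℕ y₁ ∣ + ∣ toℕ x₂ - toℕ y₂ ∣ ≡ 1

IsGraphDerangement : ∀ {m n} → (Vertex m n → Vertex m n) → Set
IsGraphDerangement {m} {n} f =
  Injective _≡_ _≡_ f × (∀ (v : Vertex m n) → Adjacent v (f v))

iter : ∀ {A : Set} → (A → A) → ℕ → A → A
iter f zero    x = x
iter f (suc j) x = f (iter f j x)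

CycleLength : ∀ {A : Set} → (A → A) → A → ℕ → Set
CycleLength f v L =
  0 < L × iter f L v ≡ v × (∀ j → 0 < j → j < L → iter f j v ≢ v)

Matchless : ∀ {A : Set} → (A → A) → Set
Matchless {A} f = ∀ (v : A) → ¬ CycleLength f v 2

SameCycle : ∀ {A : Set} → (A → A) → A → A → Set
SameCycle f u w = ∃ λ j → iter f j u ≡ w

module Submission where

-- A 4-cycle of a graph derangement of the grid is a unit square, so pairing each vertex of the given
-- cycles with its cycle-neighbour in the same row shows that in every row the given cycles use as many
-- even as odd columns.  A row has k + 1 even and k odd columns, hence if eᵣ of the remaining ("rest")
-- vertices of row r lie in odd columns, then eᵣ + 1 lie in even ones; at most 4(2k + 1) - 4(2k - 1) = 8
-- vertices remain, so e₀ + e₁ + e₂ + e₃ ≤ 2.  The rest vertices are permuted by f.  In a top or bottom row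
-- with e = 0 the single rest vertex would be sent by both f and f⁻¹ to its vertical neighbour, a 2-cycle;
-- so e₀ = e₃ = 1 and e₁ = e₂ = 0.  Following f from the single rest vertex of row 1 then either closes a
-- 2-cycle or walks along a boundary row onto its single odd rest vertex twice.

open import Defs
open import Data.Bool using (Bool; true; false; not; _∧_; if_then_else_; T)
open import Data.Bool.Properties using (∧-comm; not-involutive; T-∧)
open import Data.Empty using (⊥; ⊥-elim)
open import Data.Fin using (Fin; zero; suc; toℕ; #_; _↑ˡ_; _↑ʳ_; remQuot; combine; punchOut; _≟_)
import Data.Fin.Properties as Finₚ
open import Data.Fin.Properties
  using (injective⇒≤; toℕ-injective; toℕ<n; any?; punchOut-injective; splitAt-↑ˡ; splitAt-↑ʳ;
         remQuot-combine; combine-remQuot; combine-injective)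
open import Data.List using (tabulate)
open import Data.List.Properties using (tabulate-cong)
open import Data.Nat using (ℕ; zero; suc; _+_; _*_; _∸_; _≤_; _<_; z≤n; s≤s; s≤s⁻¹; ∣_-_∣)
open import Data.Nat.ListAction using (sum)
open import Data.Nat.Properties
  using (+-suc; suc-injective; ∣m-n∣≡0⇒m≡n; <-irrefl; ≤-antisym; 0≢1+n; +-cancelˡ-≡; +-cancelˡ-≤; *-cancelˡ-≤; +-monoˡ-≤;
         n≤0⇒n≡0; m+n≡0⇒m≡0; m+n≡0⇒n≡0; +-comm; +-identityʳ; ≤-total; m≤n⇒∃[o]m+o≡n;
         ≤-<-trans; m≤n+m; ≤-trans; ≤-reflexive; module ≤-Reasoning)
open import Data.Nat.Tactic.RingSolver using (solve-∀)
open import Data.Product using (Σ; ∃; _×_; _,_; proj₁; proj₂; swap; uncurry)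
open import Data.Product.Properties using (≡-dec)
open import Data.Sum using (_⊎_; inj₁; inj₂)
open import Data.Unit using (tt)
open import Function using (_∘_; id; Equivalence)
open import Function.Definitions using (Injective)
open import Relation.Binary.PropositionalEquality
open import Relation.Nullary using (¬_; Dec; yes; no)
open import Relation.Nullary.Decidable using (isYes; toWitness; fromWitness)

-- Counting elements of Fin n satisfying a Boolean predicate

count : ∀ {n} → (Fin n → Bool) → ℕ
count {zero}  p = 0
count {suc n} p = if p zero then suc (count (p ∘ suc)) else count (p ∘ suc)

private
  liftIf : ∀ b {m} → Fin m → Fin (if b then suc m else m)
  liftIf true  = suc
  liftIf false = id

  liftIf-injective : ∀ b {m} {i j : Fin m} → liftIf b i ≡ liftIf b j → i ≡ j
  liftIf-injective true  = Finₚ.suc-injective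
  liftIf-injective false = id

  zeroIf : ∀ b {m} → T b → Fin (if b then suc m else m)
  zeroIf true _ = zero

  zeroIf≢liftIf : ∀ b {m} (t : T b) (i : Fin m) → zeroIf b t ≢ liftIf b i
  zeroIf≢liftIf true _ _ ()

  consIf : ∀ {A : Set} b {m} → A → (Fin m → A) → Fin (if b then suc m else m) → A
  consIf true  z e zero    = z
  consIf true  z e (suc i) = e i
  consIf false z e i       = e i

index : ∀ {n} (p : Fin n → Bool) x → T (p x) → Fin (count p)
index {suc n} p zero    t = zeroIf (p zero) t
index {suc n} p (suc x) t = liftIf (p zero) (index (p ∘ suc) x t)

index-injective : ∀ {n} (p : Fin n → Bool) {x y} (tx : T (p x)) (ty : T (p y)) →
                  index p x tx ≡ index p y ty → x ≡ y
index-injective {suc n} p {zero}  {zero}  tx ty eq = refl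
index-injective {suc n} p {zero}  {suc y} tx ty eq = ⊥-elim (zeroIf≢liftIf (p zero) tx _ eq)
index-injective {suc n} p {suc x} {zero}  tx ty eq = ⊥-elim (zeroIf≢liftIf (p zero) ty _ (sym eq))
index-injective {suc n} p {suc x} {suc y} tx ty eq =
  cong suc (index-injective (p ∘ suc) tx ty (liftIf-injective (p zero) eq))

enumerate : ∀ {n} (p : Fin n → Bool) → Fin (count p) → Fin n
enumerate {suc n} p = consIf (p zero) zero (suc ∘ enumerate (p ∘ suc))

enumerate-satisfies : ∀ {n} (p : Fin n → Bool) i → T (p (enumerate p i))
enumerate-satisfies {suc n} p i with p zero in eq
... | true  with i
...   | zero  = subst T (sym eq) tt
...   | suc j = enumerate-satisfies (p ∘ suc) j
enumerate-satisfies {suc n} p i | false = enumerate-satisfies (p ∘ suc) i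

enumerate-injective : ∀ {n} (p : Fin n → Bool) {i j} → enumerate p i ≡ enumerate p j → i ≡ j
enumerate-injective {suc n} p {i} {j} eq with p zero
... | true with i | j
...   | zero  | zero  = refl
...   | suc i | suc j = cong suc (enumerate-injective (p ∘ suc) (Finₚ.suc-injective eq))
enumerate-injective {suc n} p eq | false = enumerate-injective (p ∘ suc) (Finₚ.suc-injective eq)

count-mono : ∀ {m n} (p : Fin m → Bool) (q : Fin n → Bool) (g : Fin m → Fin n) →
  (∀ x → T (p x) → T (q (g x))) →
  (∀ {x y} → T (p x) → T (p y) → g x ≡ g y → x ≡ y) →
  count p ≤ count q
count-mono p q g g-maps g-injective = injective⇒≤ {f = F} F-injective
  where
  F : Fin (count p) → Fin (count q)
  F i = index q (g (enumerate p i)) (g-maps _ (enumerate-satisfies p i))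
  F-injective : ∀ {i j} → F i ≡ F j → i ≡ j
  F-injective {i} {j} eq = enumerate-injective p
    (g-injective (enumerate-satisfies p i) (enumerate-satisfies p j) (index-injective q _ _ eq))

count≢0⇒∃ : ∀ {n} (p : Fin n → Bool) → count p ≢ 0 → ∃ (T ∘ p)
count≢0⇒∃ {zero}  p c≢0 = ⊥-elim (c≢0 refl)
count≢0⇒∃ {suc n} p c≢0 with p zero in eq
... | true  = zero , subst T (sym eq) tt
... | false with count≢0⇒∃ (p ∘ suc) c≢0
...   | x , px = suc x , px

count≡0⇒¬ : ∀ {n} (p : Fin n → Bool) → count p ≡ 0 → ∀ x → ¬ T (p x)
count≡0⇒¬ p c≡0 x px with count p | index p x px
count≡0⇒¬ p refl x px | zero | ()

count≡1⇒unique : ∀ {n} (p : Fin n → Bool) → count p ≡ 1 →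
                 ∀ {x y} → T (p x) → T (p y) → x ≡ y
count≡1⇒unique p c≡1 px py = index-injective p px py (all-equal _ _)
  where
  all-equal : (i j : Fin (count p)) → i ≡ j
  all-equal i j rewrite c≡1 with i | j
  ... | zero | zero = refl

count-cong : ∀ {n} {p q : Fin n → Bool} → (∀ x → p x ≡ q x) → count p ≡ count q
count-cong {zero}  p≗q = refl
count-cong {suc n} {p} {q} p≗q rewrite p≗q zero =
  cong (λ c → if q zero then suc c else c) (count-cong (p≗q ∘ suc))

count-const-true : ∀ n → count {n} (λ _ → true) ≡ n
count-const-true zero    = refl
count-const-true (suc n) = cong suc (count-const-true n)

count+count-not : ∀ {n} (p : Fin n → Bool) → count p + count (not ∘ p) ≡ n
count+count-not {zero}  p = refl
count+count-not {suc n} p with p zero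
... | true  = cong suc (count+count-not (p ∘ suc))
... | false = trans (+-suc _ _) (cong suc (count+count-not (p ∘ suc)))

count-∧+count-∧-not : ∀ {n} (p q : Fin n → Bool) →
  count (λ x → p x ∧ q x) + count (λ x → p x ∧ not (q x)) ≡ count p
count-∧+count-∧-not {zero}  p q = refl
count-∧+count-∧-not {suc n} p q with p zero | q zero
... | true  | true  = cong suc (count-∧+count-∧-not (p ∘ suc) (q ∘ suc))
... | true  | false = trans (+-suc _ _) (cong suc (count-∧+count-∧-not (p ∘ suc) (q ∘ suc)))
... | false | _     = count-∧+count-∧-not (p ∘ suc) (q ∘ suc)

count-↑ : ∀ m {n} (p : Fin (m + n) → Bool) →
  count p ≡ count (λ i → p (i ↑ˡ n)) + count (λ j → p (m ↑ʳ j))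
count-↑ zero    p = refl
count-↑ (suc m) p with p zero
... | true  = cong suc (count-↑ m (p ∘ suc))
... | false = count-↑ m (p ∘ suc)

count-remQuot : ∀ m {n} (p : Fin m × Fin n → Bool) →
  count {m * n} (p ∘ remQuot n) ≡ sum (tabulate λ r → count λ c → p (r , c))
count-remQuot zero    p = refl
count-remQuot (suc m) {n} p = begin
  count (p ∘ remQuot n)
    ≡⟨ count-↑ n (p ∘ remQuot n) ⟩
  count (λ c → p (remQuot n (c ↑ˡ m * n))) + count (λ j → p (remQuot n (n ↑ʳ j)))
    ≡⟨ cong₂ _+_ (count-cong λ c → cong p (remQuot-↑ˡ c)) (count-cong λ j → cong p (remQuot-↑ʳ j)) ⟩
  count (λ c → p (zero , c)) + count (λ j → p (suc (proj₁ (remQuot {m} n j)) , proj₂ (remQuot {m} n j)))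
    ≡⟨ cong (count (λ c → p (zero , c)) +_) (count-remQuot m λ (r , c) → p (suc r , c)) ⟩
  sum (tabulate λ r → count λ c → p (r , c)) ∎
  where
  open ≡-Reasoning
  remQuot-↑ˡ : ∀ c → remQuot {suc m} n (c ↑ˡ m * n) ≡ (zero , c)
  remQuot-↑ˡ c rewrite splitAt-↑ˡ n c (m * n) = refl
  remQuot-↑ʳ : ∀ j → remQuot {suc m} n (n ↑ʳ j) ≡ (suc (proj₁ (remQuot {m} n j)) , proj₂ (remQuot {m} n j))
  remQuot-↑ʳ j rewrite splitAt-↑ʳ n (m * n) j = refl

even : ℕ → Bool
even zero          = true
even (suc zero)    = false
even (suc (suc n)) = even n

count-even : ∀ j → count {2 * j + 1} (even ∘ toℕ) ≡ suc j
count-even zero    = refl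
count-even (suc j) = trans (cong (λ n → count {n} (even ∘ toℕ)) (shape j)) (cong suc (count-even j))
  where
  shape : ∀ j → 2 * suc j + 1 ≡ suc (suc (2 * j + 1))
  shape = solve-∀

count-odd : ∀ j → count {2 * j + 1} (not ∘ even ∘ toℕ) ≡ j
count-odd j = +-cancelˡ-≡ (suc j) _ j (begin
  suc j + odds           ≡⟨ cong (_+ odds) (count-even j) ⟨
  evens + odds           ≡⟨ count+count-not (even ∘ toℕ) ⟩
  2 * j + 1              ≡⟨ shape j ⟩
  suc j + j              ∎)
  where
  open ≡-Reasoning
  evens odds : ℕ
  evens = count {2 * j + 1} (even ∘ toℕ)
  odds  = count {2 * j + 1} (not ∘ even ∘ toℕ)
  shape : ∀ j → 2 * j + 1 ≡ suc j + j
  shape = solve-∀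

iter-+ : ∀ {A : Set} (f : A → A) i j x → iter f (i + j) x ≡ iter f i (iter f j x)
iter-+ f zero    j x = refl
iter-+ f (suc i) j x = cong f (iter-+ f i j x)

iter-injective : ∀ {A : Set} {f : A → A} → Injective _≡_ _≡_ f → ∀ j {x y} → iter f j x ≡ iter f j y → x ≡ y
iter-injective f-injective zero    e = e
iter-injective f-injective (suc j) e = iter-injective f-injective j (f-injective e)

-- Lattice steps in ℕ × ℕ

infix 4 _∼_

_∼_ : ℕ → ℕ → Set
a ∼ b = b ≡ suc a ⊎ a ≡ suc b

∼-sym : ∀ {a b} → a ∼ b → b ∼ a
∼-sym (inj₁ e) = inj₂ e
∼-sym (inj₂ e) = inj₁ e

∼-irrefl : ∀ {a} → ¬ a ∼ a
∼-irrefl (inj₁ ())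
∼-irrefl (inj₂ ())

∼⇒≢ : ∀ {a b} → a ∼ b → a ≢ b
∼⇒≢ a∼b refl = ∼-irrefl a∼b

∣m-n∣≡1⇒∼ : ∀ a b → ∣ a - b ∣ ≡ 1 → a ∼ b
∣m-n∣≡1⇒∼ zero          (suc zero) _ = inj₁ refl
∣m-n∣≡1⇒∼ (suc zero)    zero       _ = inj₂ refl
∣m-n∣≡1⇒∼ (suc a)       (suc b)    e with ∣m-n∣≡1⇒∼ a b e
... | inj₁ b≡1+a = inj₁ (cong suc b≡1+a)
... | inj₂ a≡1+b = inj₂ (cong suc a≡1+b)

∼-middle-unique : ∀ {a b b' c} → a ∼ b → b ∼ c → a ∼ b' → b' ∼ c → a ≢ c → b ≡ b'
∼-middle-unique (inj₁ refl) (inj₁ refl) (inj₁ refl) _           _   = refl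
∼-middle-unique (inj₁ refl) (inj₁ refl) (inj₂ refl) (inj₁ ())   _
∼-middle-unique (inj₁ refl) (inj₁ refl) (inj₂ refl) (inj₂ ())   _
∼-middle-unique (inj₂ refl) (inj₂ refl) (inj₂ refl) _           _   = refl
∼-middle-unique (inj₂ refl) (inj₂ refl) (inj₁ refl) (inj₁ ())   _
∼-middle-unique (inj₂ refl) (inj₂ refl) (inj₁ refl) (inj₂ ())   _
∼-middle-unique (inj₁ refl) (inj₂ refl) _           _           a≢c = ⊥-elim (a≢c refl)
∼-middle-unique (inj₂ refl) (inj₁ refl) _           _           a≢c = ⊥-elim (a≢c refl)

even-suc : ∀ a → even (suc a) ≡ not (even a)
even-suc zero          = refl
even-suc (suc zero)    = refl
even-suc (suc (suc a)) = even-suc a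

even-∼ : ∀ {a b} → a ∼ b → even a ≡ not (even b)
even-∼ {a} (inj₁ refl) = trans (sym (not-involutive (even a))) (cong not (sym (even-suc a)))
even-∼ {_} {b} (inj₂ refl) = even-suc b

∼-even-odd : ∀ {a b} → a ∼ b → T (even a) → T (not (even b))
∼-even-odd {a} a∼b = subst T (sym (trans (cong not (even-∼ (∼-sym a∼b))) (not-involutive (even a))))

∼-odd-even : ∀ {a b} → a ∼ b → T (not (even a)) → T (even b)
∼-odd-even a∼b = subst T (sym (even-∼ (∼-sym a∼b)))

Point : Set
Point = ℕ × ℕ

Horizontal Vertical Step : Point → Point → Set
Horizontal (r , c) (r' , c') = r ≡ r' × c ∼ c'
Vertical   (r , c) (r' , c') = r ∼ r' × c ≡ c'
Step p q = Horizontal p q ⊎ Vertical p q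

Horizontal-sym : ∀ {p q} → Horizontal p q → Horizontal q p
Horizontal-sym (r≡r' , c∼c') = sym r≡r' , ∼-sym c∼c'

Step-sym : ∀ {p q} → Step p q → Step q p
Step-sym (inj₁ (r≡r' , c∼c')) = inj₁ (sym r≡r' , ∼-sym c∼c')
Step-sym (inj₂ (r∼r' , c≡c')) = inj₂ (∼-sym r∼r' , sym c≡c')

Step-irrefl : ∀ {p} → ¬ Step p p
Step-irrefl (inj₁ (_ , c∼c)) = ∼-irrefl c∼c
Step-irrefl (inj₂ (r∼r , _)) = ∼-irrefl r∼r

Horizontal⇒¬Vertical : ∀ {p q} → Horizontal p q → ¬ Vertical p q
Horizontal⇒¬Vertical (r≡r' , _) (r∼r' , _) = ∼⇒≢ r∼r' r≡r'

taxicab≡1⇒Step : ∀ r c r' c' → ∣ r - r' ∣ + ∣ c - c' ∣ ≡ 1 → Step (r , c) (r' , c')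
taxicab≡1⇒Step r c r' c' e with ∣ r - r' ∣ in dr | ∣ c - c' ∣ in dc
... | zero     | _ = inj₁ (∣m-n∣≡0⇒m≡n dr , ∣m-n∣≡1⇒∼ c c' (trans dc e))
... | suc zero | _ = inj₂ (∣m-n∣≡1⇒∼ r r' dr , ∣m-n∣≡0⇒m≡n (trans dc (suc-injective e)))

record FourCycle (p₀ p₁ p₂ p₃ : Point) : Set where
  field
    step₀₁ : Step p₀ p₁
    step₁₂ : Step p₁ p₂
    step₂₃ : Step p₂ p₃
    step₃₀ : Step p₃ p₀
    p₂≢p₀  : p₂ ≢ p₀
    p₃≢p₁  : p₃ ≢ p₁

rotate : ∀ {p₀ p₁ p₂ p₃} → FourCycle p₀ p₁ p₂ p₃ → FourCycle p₁ p₂ p₃ p₀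
rotate γ = record
  { step₀₁ = step₁₂ ; step₁₂ = step₂₃ ; step₂₃ = step₃₀ ; step₃₀ = step₀₁
  ; p₂≢p₀ = p₃≢p₁ ; p₃≢p₁ = λ e → p₂≢p₀ (sym e) }
  where open FourCycle γ

transpose : ∀ {p₀ p₁ p₂ p₃} → FourCycle p₀ p₁ p₂ p₃ → FourCycle (swap p₀) (swap p₁) (swap p₂) (swap p₃)
transpose γ = record
  { step₀₁ = flip step₀₁ ; step₁₂ = flip step₁₂ ; step₂₃ = flip step₂₃ ; step₃₀ = flip step₃₀
  ; p₂≢p₀ = p₂≢p₀ ∘ cong swap ; p₃≢p₁ = p₃≢p₁ ∘ cong swap }
  where
  open FourCycle γ
  flip : ∀ {p q} → Step p q → Step (swap p) (swap q)
  flip (inj₁ h) = inj₂ (swap h)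
  flip (inj₂ v) = inj₁ (swap v)

FourCycle-¬horizontal² : ∀ {p₀ p₁ p₂ p₃} → FourCycle p₀ p₁ p₂ p₃ → Horizontal p₀ p₁ → ¬ Horizontal p₁ p₂
FourCycle-¬horizontal² γ h₀₁ h₁₂ = closing h₀₁ h₁₂ step₂₃ step₃₀ p₂≢p₀ p₃≢p₁
  where
  open FourCycle γ
  -- p₀ p₁ p₂ is a straight segment of length two, and p₃ is adjacent to both its ends.
  closing : ∀ {p₀ p₁ p₂ p₃} → Horizontal p₀ p₁ → Horizontal p₁ p₂ → Step p₂ p₃ → Step p₃ p₀ →
            p₂ ≢ p₀ → p₃ ≢ p₁ → ⊥
  closing (refl , c₀∼c₁) (refl , c₁∼c₂) (inj₁ (refl , c₂∼c₃)) (inj₁ (_ , c₃∼c₀)) p₂≢p₀ p₃≢p₁ =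
    p₃≢p₁ (cong (_ ,_) (sym (∼-middle-unique c₀∼c₁ c₁∼c₂ (∼-sym c₃∼c₀) (∼-sym c₂∼c₃)
                                              (λ c₀≡c₂ → p₂≢p₀ (cong (_ ,_) (sym c₀≡c₂))))))
  closing (refl , _) (refl , _) (inj₁ (refl , _)) (inj₂ (r∼r , _)) _ _ = ∼-irrefl r∼r
  closing (refl , _) (refl , _) (inj₂ (r∼r₃ , refl)) (inj₁ (r₃≡r , _)) _ _ = ∼⇒≢ r∼r₃ (sym r₃≡r)
  closing (refl , _) (refl , _) (inj₂ (_ , refl)) (inj₂ (_ , refl)) p₂≢p₀ _ = p₂≢p₀ refl

FourCycle-¬vertical² : ∀ {p₀ p₁ p₂ p₃} → FourCycle p₀ p₁ p₂ p₃ → Vertical p₀ p₁ → ¬ Vertical p₁ p₂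
FourCycle-¬vertical² γ v₀₁ v₁₂ = FourCycle-¬horizontal² (transpose γ) (swap v₀₁) (swap v₁₂)

FourCycle-vertical⇒previous-horizontal : ∀ {p₀ p₁ p₂ p₃} → FourCycle p₀ p₁ p₂ p₃ → Vertical p₀ p₁ → Horizontal p₃ p₀
FourCycle-vertical⇒previous-horizontal γ v₀₁ with FourCycle.step₃₀ γ
... | inj₁ h₃₀ = h₃₀
... | inj₂ v₃₀ = ⊥-elim (FourCycle-¬vertical² (rotate (rotate (rotate γ))) v₃₀ v₀₁)

-- Graph derangements of the grid

injective⇒surjective : ∀ {m} (g : Fin m → Fin m) → Injective _≡_ _≡_ g → ∀ y → ∃ λ x → g x ≡ y
injective⇒surjective {suc m} g g-injective y with any? (λ x → g x ≟ y)
... | yes hit = hit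
... | no miss = ⊥-elim (<-irrefl refl (injective⇒≤ {f = avoid} avoid-injective))
  where
  avoid : Fin (suc m) → Fin m
  avoid x = punchOut {i = y} {j = g x} (λ y≡gx → miss (x , sym y≡gx))
  avoid-injective : Injective _≡_ _≡_ avoid
  avoid-injective e = g-injective (punchOut-injective {i = y} _ _ e)

evenInRow oddInRow : ∀ {m n} → (Vertex m n → Bool) → Fin m → ℕ
evenInRow S r = count λ c → even (toℕ c) ∧ S (r , c)
oddInRow  S r = count λ c → not (even (toℕ c)) ∧ S (r , c)

module Derangement {m n : ℕ} (f : Vertex m n → Vertex m n) (f-injective : Injective _≡_ _≡_ f)
  (f-adjacent : ∀ v → Adjacent v (f v)) (matchless : Matchless f) where

  point : Vertex m n → Point
  point (r , c) = toℕ r , toℕ c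

  point-injective : ∀ {u v} → point u ≡ point v → u ≡ v
  point-injective e = cong₂ _,_ (toℕ-injective (cong proj₁ e)) (toℕ-injective (cong proj₂ e))

  f-step : ∀ v → Step (point v) (point (f v))
  f-step v = taxicab≡1⇒Step _ _ _ _ (f-adjacent v)

  f-irreflexive : ∀ v → f v ≢ v
  f-irreflexive v fv≡v = Step-irrefl (subst (λ w → Step (point v) (point w)) fv≡v (f-step v))

  f²-irreflexive : ∀ v → f (f v) ≢ v
  f²-irreflexive v f²v≡v = matchless v (s≤s z≤n , f²v≡v , λ { (suc zero) _ _ → f-irreflexive v ; (suc (suc _)) _ (s≤s (s≤s ())) })

  private
    encode : Vertex m n → Fin (m * n)
    encode = uncurry combine

    f-coded : Fin (m * n) → Fin (m * n)
    f-coded = encode ∘ f ∘ remQuot n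

    f-coded-injective : Injective _≡_ _≡_ f-coded
    f-coded-injective {x} {y} e = begin
      x                          ≡⟨ combine-remQuot {m} n x ⟨
      encode (remQuot {m} n x)   ≡⟨ cong encode (f-injective (begin
        f (remQuot n x)          ≡⟨ remQuot-combine (proj₁ (f (remQuot n x))) (proj₂ (f (remQuot n x))) ⟨
        remQuot n (f-coded x)    ≡⟨ cong (remQuot n) e ⟩
        remQuot n (f-coded y)    ≡⟨ remQuot-combine (proj₁ (f (remQuot n y))) (proj₂ (f (remQuot n y))) ⟩
        f (remQuot n y)          ∎)) ⟩
      encode (remQuot n y)       ≡⟨ combine-remQuot {m} n y ⟩
      y                          ∎
      where open ≡-Reasoning

    preimage : ∀ v → ∃ λ x → f-coded x ≡ encode v
    preimage v = injective⇒surjective f-coded f-coded-injective (encode v)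

  predecessor : Vertex m n → Vertex m n
  predecessor v = remQuot n (proj₁ (preimage v))

  f-predecessor : ∀ v → f (predecessor v) ≡ v
  f-predecessor v = begin
    f (predecessor v)                     ≡⟨ remQuot-combine (proj₁ (f (predecessor v))) (proj₂ (f (predecessor v))) ⟨
    remQuot n (f-coded (proj₁ (preimage v))) ≡⟨ cong (remQuot n) (proj₂ (preimage v)) ⟩
    remQuot n (encode v)                  ≡⟨ remQuot-combine (proj₁ v) (proj₂ v) ⟩
    v                                     ∎
    where open ≡-Reasoning

  predecessor-step : ∀ v → Step (point v) (point (predecessor v))
  predecessor-step v = Step-sym (subst (λ w → Step (point (predecessor v)) (point w)) (f-predecessor v)
                                       (f-step (predecessor v)))

  fourCycle : ∀ {v} → f (f (f (f v))) ≡ v →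
              FourCycle (point v) (point (f v)) (point (f (f v))) (point (f (f (f v))))
  fourCycle {v} f⁴v≡v = record
    { step₀₁ = f-step v
    ; step₁₂ = f-step (f v)
    ; step₂₃ = f-step (f (f v))
    ; step₃₀ = subst (λ w → Step (point (f (f (f v)))) (point w)) f⁴v≡v (f-step (f (f (f v))))
    ; p₂≢p₀  = f²-irreflexive v ∘ point-injective
    ; p₃≢p₁  = f²-irreflexive (f v) ∘ point-injective
    }

  -- On a 4-cycle f³ = f⁻¹, so partner v is the neighbour of v on its cycle lying in the same row.
  partner : Vertex m n → Vertex m n
  partner v with f-step v
  ... | inj₁ _ = f v
  ... | inj₂ _ = f (f (f v))

  partner-horizontal : ∀ {v} → f (f (f (f v))) ≡ v → Horizontal (point v) (point (partner v))
  partner-horizontal {v} f⁴v≡v with f-step v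
  ... | inj₁ h₀₁ = h₀₁
  ... | inj₂ v₀₁ = Horizontal-sym (FourCycle-vertical⇒previous-horizontal (fourCycle f⁴v≡v) v₀₁)

  partner-involutive : ∀ {v} → f (f (f (f v))) ≡ v → partner (partner v) ≡ v
  partner-involutive {v} f⁴v≡v with f-step v
  ... | inj₁ h₀₁ with f-step (f v)
  ...   | inj₁ h₁₂ = ⊥-elim (FourCycle-¬horizontal² (fourCycle f⁴v≡v) h₀₁ h₁₂)
  ...   | inj₂ _   = f⁴v≡v
  partner-involutive {v} f⁴v≡v | inj₂ v₀₁ with f-step (f (f (f v)))
  ...   | inj₁ _   = f⁴v≡v
  ...   | inj₂ v₃₄ = ⊥-elim (Horizontal⇒¬Vertical (FourCycle-vertical⇒previous-horizontal (fourCycle f⁴v≡v) v₀₁)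
                       (subst (λ w → Vertical (point (f (f (f v)))) (point w)) f⁴v≡v v₃₄))

  partner-orbit : ∀ v → partner v ≡ f v ⊎ partner v ≡ f (f (f v))
  partner-orbit v with f-step v
  ... | inj₁ _ = inj₁ refl
  ... | inj₂ _ = inj₂ refl

  module _ (S : Vertex m n → Bool) (S-f : ∀ {v} → T (S v) → T (S (f v)))
           (S-periodic : ∀ {v} → T (S v) → f (f (f (f v))) ≡ v) where

    private
      S-partner : ∀ {v} → T (S v) → T (S (partner v))
      S-partner {v} s with partner-orbit v
      ... | inj₁ e = subst (T ∘ S) (sym e) (S-f s)
      ... | inj₂ e = subst (T ∘ S) (sym e) (S-f (S-f (S-f s)))

      partner-count-≤ : ∀ r (p q : Fin n → Bool) → (∀ {c c'} → toℕ c ∼ toℕ c' → T (p c) → T (q c')) →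
        count (λ c → p c ∧ S (r , c)) ≤ count (λ c → q c ∧ S (r , c))
      partner-count-≤ r p q p⇒q = count-mono _ _ column maps injective
        where
        column : Fin n → Fin n
        column c = proj₂ (partner (r , c))

        on-row : ∀ {c} → T (S (r , c)) → partner (r , c) ≡ (r , column c)
        on-row {c} s = cong (_, column c) (sym (toℕ-injective (proj₁ (partner-horizontal (S-periodic s)))))

        maps : ∀ c → T (p c ∧ S (r , c)) → T (q (column c) ∧ S (r , column c))
        maps c t with Equivalence.to (T-∧ {p c}) t
        ... | pc , s = Equivalence.from T-∧
          (p⇒q (proj₂ (partner-horizontal (S-periodic s))) pc , subst (T ∘ S) (on-row s) (S-partner s))

        injective : ∀ {c c'} → T (p c ∧ S (r , c)) → T (p c' ∧ S (r , c')) → column c ≡ column c' → c ≡ c'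
        injective {c} {c'} t t' e = cong proj₂ (begin
          (r , c)                    ≡⟨ partner-involutive (S-periodic s) ⟨
          partner (partner (r , c))  ≡⟨ cong partner (trans (on-row s) (trans (cong (r ,_) e) (sym (on-row s')))) ⟩
          partner (partner (r , c')) ≡⟨ partner-involutive (S-periodic s') ⟩
          (r , c')                   ∎)
          where
          open ≡-Reasoning
          s  : T (S (r , c))
          s  = proj₂ (Equivalence.to (T-∧ {p c}) t)
          s' : T (S (r , c'))
          s' = proj₂ (Equivalence.to (T-∧ {p c'}) t')

    row-balance : ∀ r → evenInRow S r ≡ oddInRow S r
    row-balance r = ≤-antisym (partner-count-≤ r _ _ ∼-even-odd) (partner-count-≤ r _ _ ∼-odd-even)

-- Rest vertices in G_{4,n}

BoundaryRow : Fin 4 → Fin 4 → Set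
BoundaryRow a b = ∀ r → toℕ a ∼ toℕ r → r ≡ b

boundaryRow-top : BoundaryRow zero (suc zero)
boundaryRow-top zero                   (inj₁ ())
boundaryRow-top zero                   (inj₂ ())
boundaryRow-top (suc zero)             _ = refl
boundaryRow-top (suc (suc zero))       (inj₁ ())
boundaryRow-top (suc (suc zero))       (inj₂ ())
boundaryRow-top (suc (suc (suc zero))) (inj₁ ())
boundaryRow-top (suc (suc (suc zero))) (inj₂ ())

boundaryRow-bottom : BoundaryRow (suc (suc (suc zero))) (suc (suc zero))
boundaryRow-bottom zero                   (inj₁ ())
boundaryRow-bottom zero                   (inj₂ ())
boundaryRow-bottom (suc zero)             (inj₁ ())
boundaryRow-bottom (suc zero)             (inj₂ ())
boundaryRow-bottom (suc (suc zero))       _ = refl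
boundaryRow-bottom (suc (suc (suc zero))) (inj₁ ())
boundaryRow-bottom (suc (suc (suc zero))) (inj₂ ())

neighbourRows-1 : ∀ (r : Fin 4) → 1 ∼ toℕ r → r ≡ zero ⊎ r ≡ suc (suc zero)
neighbourRows-1 zero                   _ = inj₁ refl
neighbourRows-1 (suc zero)             (inj₁ ())
neighbourRows-1 (suc zero)             (inj₂ ())
neighbourRows-1 (suc (suc zero))       _ = inj₂ refl
neighbourRows-1 (suc (suc (suc zero))) (inj₁ ())
neighbourRows-1 (suc (suc (suc zero))) (inj₂ ())

neighbourRows-2 : ∀ (r : Fin 4) → 2 ∼ toℕ r → r ≡ suc zero ⊎ r ≡ suc (suc (suc zero))
neighbourRows-2 zero                   (inj₁ ())
neighbourRows-2 zero                   (inj₂ ())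
neighbourRows-2 (suc zero)             _ = inj₁ refl
neighbourRows-2 (suc (suc zero))       (inj₁ ())
neighbourRows-2 (suc (suc zero))       (inj₂ ())
neighbourRows-2 (suc (suc (suc zero))) _ = inj₂ refl

module BoundaryRows {n : ℕ} (f : Vertex 4 n → Vertex 4 n) (f-injective : Injective _≡_ _≡_ f)
  (f-adjacent : ∀ v → Adjacent v (f v)) (matchless : Matchless f)
  (rest : Vertex 4 n → Bool)
  (rest-f : ∀ {v} → T (rest v) → T (rest (f v)))
  (rest-f⁻ : ∀ {v} → T (rest (f v)) → T (rest v))
  (rest-row : ∀ r → evenInRow rest r ≡ suc (oddInRow rest r)) where

  open Derangement f f-injective f-adjacent matchless

  Rest : Vertex 4 n → Set
  Rest = T ∘ rest

  Lonely : Fin 4 → Set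
  Lonely r = oddInRow rest r ≡ 0

  rest-predecessor : ∀ {v} → Rest v → Rest (predecessor v)
  rest-predecessor {v} t = rest-f⁻ (subst Rest (sym (f-predecessor v)) t)

  rest-in-row : ∀ r → ∃ λ c → Rest (r , c)
  rest-in-row r with count≢0⇒∃ (λ c → even (toℕ c) ∧ rest (r , c)) (λ e → 0≢1+n (trans (sym e) (rest-row r)))
  ... | c , t = c , proj₂ (Equivalence.to (T-∧ {even (toℕ c)}) t)

  lonely⇒even : ∀ {r c} → Lonely r → Rest (r , c) → T (even (toℕ c))
  lonely⇒even {r} {c} lonely t with even (toℕ c) in eq
  ... | true  = tt
  ... | false = count≡0⇒¬ (λ c → not (even (toℕ c)) ∧ rest (r , c)) lonely c
                  (Equivalence.from T-∧ (subst (T ∘ not) (sym eq) tt , t))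

  lonely⇒unique : ∀ {r c c'} → Lonely r → Rest (r , c) → Rest (r , c') → c ≡ c'
  lonely⇒unique {r} lonely t t' = count≡1⇒unique (λ c → even (toℕ c) ∧ rest (r , c))
    (trans (rest-row r) (cong suc lonely))
    (Equivalence.from T-∧ (lonely⇒even lonely t , t)) (Equivalence.from T-∧ (lonely⇒even lonely t' , t'))

  odd-unique : ∀ {r c c'} → oddInRow rest r ≡ 1 →
    Rest (r , c) → T (not (even (toℕ c))) → Rest (r , c') → T (not (even (toℕ c'))) → c ≡ c'
  odd-unique {r} one t o t' o' = count≡1⇒unique (λ c → not (even (toℕ c)) ∧ rest (r , c)) one
    (Equivalence.from T-∧ (o , t)) (Equivalence.from T-∧ (o' , t'))

  lonely-neighbour : ∀ {r c v} → Lonely r → Rest (r , c) → Rest v → Step (point (r , c)) (point v) →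
                     ∃ λ r' → toℕ r ∼ toℕ r' × v ≡ (r' , c)
  lonely-neighbour {r} {c} {r' , c'} lonely t t' (inj₁ (r≡r' , c∼c')) = ⊥-elim (∼⇒≢ c∼c'
    (cong toℕ (lonely⇒unique lonely t (subst (λ x → Rest (x , c')) (sym (toℕ-injective r≡r')) t'))))
  lonely-neighbour {r} {c} {r' , c'} lonely t t' (inj₂ (r∼r' , c≡c')) =
    r' , r∼r' , cong (r' ,_) (sym (toℕ-injective c≡c'))

  -- f and f⁻¹ both move the only rest vertex of row a to a rest vertex of row b in the same column.
  boundary-not-lonely : ∀ {a b} → BoundaryRow a b → ¬ Lonely a
  boundary-not-lonely {a} {b} boundary lonely with rest-in-row a
  ... | c , t = f²-irreflexive (a , c) (begin
    f (f (a , c))             ≡⟨ cong f (trans (below (rest-f t) (f-step _))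
                                               (sym (below (rest-predecessor t) (predecessor-step _)))) ⟩
    f (predecessor (a , c))   ≡⟨ f-predecessor _ ⟩
    (a , c)                   ∎)
    where
    open ≡-Reasoning
    below : ∀ {v} → Rest v → Step (point (a , c)) (point v) → v ≡ (b , c)
    below t' step with lonely-neighbour lonely t t' step
    ... | r' , a∼r' , v≡r'c = trans v≡r'c (cong (_, c) (boundary r' a∼r'))

  BoundaryExit : Fin 4 → Fin 4 → Fin n → Fin n → Set
  BoundaryExit a b c c' = (c' ≡ c × f (a , c') ≡ (b , c)) ⊎ (∃ λ c'' → toℕ c' ∼ toℕ c'' × f (a , c') ≡ (a , c''))

  boundaryExit : ∀ {a b c c'} → BoundaryRow a b → Lonely b → Rest (b , c) → Rest (a , c') → BoundaryExit a b c c'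
  boundaryExit {a} {b} {c} {c'} boundary lonely t t' with f (a , c') | f-step (a , c') | rest-f t'
  ... | r'' , c'' | inj₁ (a≡r'' , c'∼c'') | _ =
    inj₂ (c'' , c'∼c'' , cong (_, c'') (sym (toℕ-injective a≡r'')))
  ... | r'' , c'' | inj₂ (a∼r'' , c'≡c'') | t'' with boundary r'' a∼r''
  ...   | refl with lonely⇒unique lonely t t''
  ...     | refl = inj₁ (toℕ-injective c'≡c'' , refl)

  -- Once in row a, the orbit of (b , c) cannot step down again (the only rest vertex of row b is (b , c)),
  -- so it moves along row a through columns of parity odd, even, odd; the two odd ones must coincide.
  ¬enter-boundary-row : ∀ {a b c} → BoundaryRow a b → Lonely b → Rest (b , c) → oddInRow rest a ≡ 1 →
                        f (b , c) ≢ (a , c)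
  ¬enter-boundary-row {a} {b} {c} boundary lonely t one f-bc = first (exit t₀)
    where
    exit : ∀ {c'} → Rest (a , c') → BoundaryExit a b c c'
    exit = boundaryExit boundary lonely t
    t₀ : Rest (a , c)
    t₀ = subst Rest f-bc (rest-f t)

    first : BoundaryExit a b c c → ⊥
    first (inj₁ (_ , f-ac)) = f²-irreflexive (b , c) (trans (cong f f-bc) f-ac)
    first (inj₂ (c₁ , c∼c₁ , f₀)) = second (exit t₁)
      where
      t₁ : Rest (a , c₁)
      t₁ = subst Rest f₀ (rest-f t₀)
      odd₁ : T (not (even (toℕ c₁)))
      odd₁ = ∼-even-odd c∼c₁ (lonely⇒even lonely t)

      second : BoundaryExit a b c c₁ → ⊥
      second (inj₁ (c₁≡c , _)) = ∼⇒≢ c∼c₁ (cong toℕ (sym c₁≡c))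
      second (inj₂ (c₂ , c₁∼c₂ , f₁)) = third (exit t₂)
        where
        t₂ : Rest (a , c₂)
        t₂ = subst Rest f₁ (rest-f t₁)

        third : BoundaryExit a b c c₂ → ⊥
        third (inj₁ (c₂≡c , _)) = f²-irreflexive (a , c) (trans (cong f f₀) (trans f₁ (cong (a ,_) c₂≡c)))
        third (inj₂ (c₃ , c₂∼c₃ , f₂)) =
          f²-irreflexive (a , c₁) (trans (cong f f₁) (trans f₂ (cong (a ,_) c₃≡c₁)))
          where
          c₃≡c₁ : c₃ ≡ c₁
          c₃≡c₁ = odd-unique one (subst Rest f₂ (rest-f t₂)) (∼-even-odd c₂∼c₃ (∼-odd-even c₁∼c₂ odd₁)) t₁ odd₁

  ¬middle-rows-lonely : oddInRow rest zero ≡ 1 → Lonely (suc zero) → Lonely (suc (suc zero)) →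
                        oddInRow rest (suc (suc (suc zero))) ≡ 1 → ⊥
  ¬middle-rows-lonely one₀ lonely₁ lonely₂ one₃ with rest-in-row (suc zero) | rest-in-row (suc (suc zero))
  ... | c₁ , t₁ | c₂ , t₂ with lonely-neighbour lonely₁ t₁ (rest-f t₁) (f-step _)
  ...   | r , 1∼r , f₁≡ with neighbourRows-1 r 1∼r
  ...     | inj₁ refl = ¬enter-boundary-row boundaryRow-top lonely₁ t₁ one₀ f₁≡
  ...     | inj₂ refl with lonely⇒unique lonely₂ (subst Rest f₁≡ (rest-f t₁)) t₂
  ...       | refl with lonely-neighbour lonely₂ t₂ (rest-f t₂) (f-step _)
  ...         | r' , 2∼r' , f₂≡ with neighbourRows-2 r' 2∼r'
  ...           | inj₁ refl = f²-irreflexive _ (trans (cong f f₁≡) f₂≡)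
  ...           | inj₂ refl = ¬enter-boundary-row boundaryRow-bottom lonely₂ t₂ one₃ f₂≡

deficit-sum≤2 : ∀ k (s e : Fin 4 → ℕ) → 1 ≤ k → (∀ r → s r + e r ≡ k) →
  (2 * k ∸ 1) * 4 ≤ sum (tabulate λ r → s r + s r) → sum (tabulate e) ≤ 2
deficit-sum≤2 (suc k) s e _ row bound = *-cancelˡ-≤ 2 (+-cancelˡ-≤ ((2 * suc k ∸ 1) * 4 + 4) _ _ (begin
  (2 * suc k ∸ 1) * 4 + 4 + 2 * E                ≤⟨ +-monoˡ-≤ (2 * E) (+-monoˡ-≤ 4 bound) ⟩
  S + 4 + 2 * E                                  ≡⟨ regroup s₀ s₁ s₂ s₃ e₀ e₁ e₂ e₃ ⟨
  4 + 2 * ((s₀ + e₀) + ((s₁ + e₁) + ((s₂ + e₂) + (s₃ + e₃))))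
    ≡⟨ cong (λ t → 4 + 2 * t) (cong₂ _+_ (row _) (cong₂ _+_ (row _) (cong₂ _+_ (row _) (row _)))) ⟩
  4 + 2 * (suc k + (suc k + (suc k + suc k)))    ≡⟨ total k ⟩
  (2 * suc k ∸ 1) * 4 + 4 + 2 * 2                ∎))
  where
  open ≤-Reasoning
  s₀ s₁ s₂ s₃ e₀ e₁ e₂ e₃ E S : ℕ
  s₀ = s (# 0); s₁ = s (# 1); s₂ = s (# 2); s₃ = s (# 3)
  e₀ = e (# 0); e₁ = e (# 1); e₂ = e (# 2); e₃ = e (# 3)
  E = sum (tabulate e)
  S = sum (tabulate λ r → s r + s r)
  regroup : ∀ s₀ s₁ s₂ s₃ e₀ e₁ e₂ e₃ →
    4 + 2 * ((s₀ + e₀) + ((s₁ + e₁) + ((s₂ + e₂) + (s₃ + e₃)))) ≡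
    (s₀ + s₀) + ((s₁ + s₁) + ((s₂ + s₂) + ((s₃ + s₃) + 0))) + 4 + 2 * (e₀ + (e₁ + (e₂ + (e₃ + 0))))
  regroup = solve-∀
  total : ∀ k → 4 + 2 * (suc k + (suc k + (suc k + suc k))) ≡ (k + suc (k + 0)) * 4 + 4 + 2 * 2
  total = solve-∀

only-ends : ∀ a b c d → a + (b + (c + (d + 0))) ≤ 2 → a ≢ 0 → d ≢ 0 → a ≡ 1 × b ≡ 0 × c ≡ 0 × d ≡ 1
only-ends zero    _ _ _       _  a≢0 _   = ⊥-elim (a≢0 refl)
only-ends (suc a) _ _ zero    _  _   d≢0 = ⊥-elim (d≢0 refl)
only-ends (suc a) b c (suc d) le _   _   =
  cong suc (m+n≡0⇒m≡0 a sum≡0) , m+n≡0⇒m≡0 b b+c+d≡0 , m+n≡0⇒m≡0 c c+d≡0 , cong suc (m+n≡0⇒n≡0 c c+d≡0)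
  where
  move-suc : ∀ a b c d → a + (b + (c + (suc d + 0))) ≡ suc (a + (b + (c + d)))
  move-suc = solve-∀
  sum≡0 : a + (b + (c + d)) ≡ 0
  sum≡0 = n≤0⇒n≡0 (s≤s⁻¹ (s≤s⁻¹ (subst (_≤ 2) (cong suc (move-suc a b c d)) le)))
  b+c+d≡0 : b + (c + d) ≡ 0
  b+c+d≡0 = m+n≡0⇒n≡0 a sum≡0
  c+d≡0 : c + d ≡ 0
  c+d≡0 = m+n≡0⇒n≡0 b b+c+d≡0

-- The given 4-cycles

module GivenCycles (k : ℕ) (f : Vertex 4 (2 * k + 1) → Vertex 4 (2 * k + 1))
  (f-injective : Injective _≡_ _≡_ f) (f-adjacent : ∀ v → Adjacent v (f v)) (matchless : Matchless f)
  (vs : Fin (2 * k ∸ 1) → Vertex 4 (2 * k + 1)) (cycle : ∀ i → CycleLength f (vs i) 4)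
  (disjoint : ∀ i j → i ≢ j → ¬ SameCycle f (vs i) (vs j)) where

  open Derangement f f-injective f-adjacent matchless

  private
    n : ℕ
    n = 2 * k + 1

  period : ∀ i → f (f (f (f (vs i)))) ≡ vs i
  period i = proj₁ (proj₂ (cycle i))

  OnGivenCycle : Vertex 4 n → Set
  OnGivenCycle v = ∃ λ i → ∃ λ (j : Fin 4) → iter f (toℕ j) (vs i) ≡ v

  onGivenCycle? : ∀ v → Dec (OnGivenCycle v)
  onGivenCycle? v = any? λ i → any? λ j → ≡-dec _≟_ _≟_ (iter f (toℕ j) (vs i)) v

  onGivenCycle-f : ∀ {v} → OnGivenCycle v → OnGivenCycle (f v)
  onGivenCycle-f (i , zero , e)                   = i , # 1 , cong f e
  onGivenCycle-f (i , suc zero , e)               = i , # 2 , cong f e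
  onGivenCycle-f (i , suc (suc zero) , e)         = i , # 3 , cong f e
  onGivenCycle-f (i , suc (suc (suc zero)) , e)   = i , # 0 , trans (sym (period i)) (cong f e)

  onGivenCycle-f⁻ : ∀ {v} → OnGivenCycle (f v) → OnGivenCycle v
  onGivenCycle-f⁻ (i , zero , e)                  = i , # 3 , f-injective (trans (period i) e)
  onGivenCycle-f⁻ (i , suc zero , e)              = i , # 0 , f-injective e
  onGivenCycle-f⁻ (i , suc (suc zero) , e)        = i , # 1 , f-injective e
  onGivenCycle-f⁻ (i , suc (suc (suc zero)) , e)  = i , # 2 , f-injective e

  onGivenCycle-periodic : ∀ {v} → OnGivenCycle v → f (f (f (f v))) ≡ v
  onGivenCycle-periodic (i , j , refl) = begin
    iter f 4 (iter f (toℕ j) (vs i))   ≡⟨ iter-+ f 4 (toℕ j) (vs i) ⟨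
    iter f (4 + toℕ j) (vs i)          ≡⟨ cong (λ t → iter f t (vs i)) (+-comm 4 (toℕ j)) ⟩
    iter f (toℕ j + 4) (vs i)          ≡⟨ iter-+ f (toℕ j) 4 (vs i) ⟩
    iter f (toℕ j) (iter f 4 (vs i))   ≡⟨ cong (iter f (toℕ j)) (period i) ⟩
    iter f (toℕ j) (vs i)              ∎
    where open ≡-Reasoning

  private
    orbit-injective-≤ : ∀ {i i' j j'} → toℕ j ≤ toℕ j' →
                        iter f (toℕ j) (vs i) ≡ iter f (toℕ j') (vs i') → (i , j) ≡ (i' , j')
    orbit-injective-≤ {i} {i'} {j} {j'} j≤j' e with m≤n⇒∃[o]m+o≡n j≤j'
    ... | d , j+d≡j' with i ≟ i' | iter-injective f-injective (toℕ j)
                                     (trans e (trans (cong (λ t → iter f t (vs i')) (sym j+d≡j'))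
                                                     (iter-+ f (toℕ j) d (vs i'))))
    ...   | no i≢i'  | vsᵢ≡ = ⊥-elim (disjoint i' i (i≢i' ∘ sym) (d , sym vsᵢ≡))
    ...   | yes refl | vsᵢ≡ with d
    ...     | zero   = cong (i ,_) (toℕ-injective (trans (sym (+-identityʳ (toℕ j))) j+d≡j'))
    ...     | suc d' = ⊥-elim (proj₂ (proj₂ (cycle i)) (suc d') (s≤s z≤n)
                         (≤-<-trans (m≤n+m (suc d') (toℕ j)) (subst (_< 4) (sym j+d≡j') (toℕ<n j')))
                         (sym vsᵢ≡))

  orbit-injective : ∀ {i i' j j'} → iter f (toℕ j) (vs i) ≡ iter f (toℕ j') (vs i') → (i , j) ≡ (i' , j')
  orbit-injective {j = j} {j'} e with ≤-total (toℕ j) (toℕ j')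
  ... | inj₁ j≤j' = orbit-injective-≤ j≤j' e
  ... | inj₂ j'≤j = sym (orbit-injective-≤ j'≤j (sym e))

  square rest : Vertex 4 n → Bool
  square v = isYes (onGivenCycle? v)
  rest     = not ∘ square

  square-f : ∀ {v} → T (square v) → T (square (f v))
  square-f = fromWitness ∘ onGivenCycle-f ∘ toWitness

  square-periodic : ∀ {v} → T (square v) → f (f (f (f v))) ≡ v
  square-periodic = onGivenCycle-periodic ∘ toWitness

  rest-f : ∀ {v} → T (rest v) → T (rest (f v))
  rest-f {v} t with onGivenCycle? v | onGivenCycle? (f v)
  ... | no ¬on | yes on = ¬on (onGivenCycle-f⁻ on)
  ... | no _   | no _   = tt

  rest-f⁻ : ∀ {v} → T (rest (f v)) → T (rest v)
  rest-f⁻ {v} t with onGivenCycle? v | onGivenCycle? (f v)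
  ... | yes on | no ¬on = ¬on (onGivenCycle-f on)
  ... | no _   | _      = tt

  balanced : ∀ r → evenInRow square r ≡ oddInRow square r
  balanced = row-balance square square-f square-periodic

  odd-columns : ∀ r → oddInRow square r + oddInRow rest r ≡ k
  odd-columns r = trans (count-∧+count-∧-not (not ∘ even ∘ toℕ) (λ c → square (r , c))) (count-odd k)

  rest-row : ∀ r → evenInRow rest r ≡ suc (oddInRow rest r)
  rest-row r = +-cancelˡ-≡ (evenInRow square r) _ _ (begin
    evenInRow square r + evenInRow rest r      ≡⟨ count-∧+count-∧-not (even ∘ toℕ) (λ c → square (r , c)) ⟩
    count {n} (even ∘ toℕ)                     ≡⟨ count-even k ⟩
    suc k                                      ≡⟨ cong suc (odd-columns r) ⟨
    suc (oddInRow square r + oddInRow rest r)  ≡⟨ +-suc (oddInRow square r) (oddInRow rest r) ⟨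
    oddInRow square r + suc (oddInRow rest r)  ≡⟨ cong (_+ suc (oddInRow rest r)) (balanced r) ⟨
    evenInRow square r + suc (oddInRow rest r) ∎)
    where open ≡-Reasoning

  squares-in-row : ∀ r → count (λ c → square (r , c)) ≡ evenInRow square r + evenInRow square r
  squares-in-row r = begin
    count (λ c → square (r , c))                         ≡⟨ count-∧+count-∧-not (λ c → square (r , c)) (even ∘ toℕ) ⟨
    count (λ c → square (r , c) ∧ even (toℕ c)) + count (λ c → square (r , c) ∧ not (even (toℕ c)))
      ≡⟨ cong₂ _+_ (count-cong λ c → ∧-comm (square (r , c)) _) (count-cong λ c → ∧-comm (square (r , c)) _) ⟩
    evenInRow square r + oddInRow square r               ≡⟨ cong (evenInRow square r +_) (balanced r) ⟨
    evenInRow square r + evenInRow square r              ∎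
    where open ≡-Reasoning

  squares-total : (2 * k ∸ 1) * 4 ≤ sum (tabulate λ r → count λ c → square (r , c))
  squares-total = begin
    (2 * k ∸ 1) * 4                      ≡⟨ count-const-true _ ⟨
    count {(2 * k ∸ 1) * 4} (λ _ → true)  ≤⟨ count-mono _ (square ∘ remQuot n) position on-cycle position-injective ⟩
    count {4 * n} (square ∘ remQuot n)   ≡⟨ count-remQuot 4 square ⟩
    sum (tabulate λ r → count λ c → square (r , c)) ∎
    where
    open ≤-Reasoning
    vertex : Fin (2 * k ∸ 1) × Fin 4 → Vertex 4 n
    vertex (i , j) = iter f (toℕ j) (vs i)
    position : Fin ((2 * k ∸ 1) * 4) → Fin (4 * n)
    position = uncurry combine ∘ vertex ∘ remQuot 4
    on-cycle : ∀ x → T true → T (square (remQuot n (position x)))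
    on-cycle x _ = fromWitness (subst OnGivenCycle (sym (remQuot-combine _ _)) (proj₁ ij , proj₂ ij , refl))
      where
      ij : Fin (2 * k ∸ 1) × Fin 4
      ij = remQuot {2 * k ∸ 1} 4 x
    position-injective : ∀ {x y} → T true → T true → position x ≡ position y → x ≡ y
    position-injective {x} {y} _ _ e with combine-injective _ _ _ _ e
    ... | r≡ , c≡ = trans (sym (combine-remQuot {2 * k ∸ 1} 4 x))
      (trans (cong (uncurry combine) (orbit-injective (cong₂ _,_ r≡ c≡))) (combine-remQuot {2 * k ∸ 1} 4 y))

  open BoundaryRows f f-injective f-adjacent matchless rest rest-f rest-f⁻ rest-row

  impossible : 1 ≤ k → ⊥
  impossible 1≤k = conclude (only-ends e₀ e₁ e₂ e₃ excess (boundary-not-lonely boundaryRow-top)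
                                                         (boundary-not-lonely boundaryRow-bottom))
    where
    e₀ e₁ e₂ e₃ : ℕ
    e₀ = oddInRow rest (# 0); e₁ = oddInRow rest (# 1); e₂ = oddInRow rest (# 2); e₃ = oddInRow rest (# 3)
    row-sum : ∀ r → evenInRow square r + oddInRow rest r ≡ k
    row-sum r = trans (cong (_+ oddInRow rest r) (balanced r)) (odd-columns r)
    bound : (2 * k ∸ 1) * 4 ≤ sum (tabulate λ r → evenInRow square r + evenInRow square r)
    bound = ≤-trans squares-total (≤-reflexive (cong sum (tabulate-cong squares-in-row)))
    excess : e₀ + (e₁ + (e₂ + (e₃ + 0))) ≤ 2
    excess = deficit-sum≤2 k (evenInRow square) (oddInRow rest) 1≤k row-sum bound
    conclude : e₀ ≡ 1 × e₁ ≡ 0 × e₂ ≡ 0 × e₃ ≡ 1 → ⊥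
    conclude (one₀ , lonely₁ , lonely₂ , one₃) = ¬middle-rows-lonely one₀ lonely₁ lonely₂ one₃

proposition20 : (k : ℕ) → 1 ≤ k →
    (f : Vertex 4 (2 * k + 1) → Vertex 4 (2 * k + 1)) →
    IsGraphDerangement f → Matchless f →
    ¬ (Σ (Fin (2 * k ∸ 1) → Vertex 4 (2 * k + 1)) λ vs →
         (∀ i → CycleLength f (vs i) 4) ×
         (∀ i j → i ≢ j → ¬ SameCycle f (vs i) (vs j)))
proposition20 k 1≤k f (f-injective , f-adjacent) matchless (vs , cycle , disjoint) =
  GivenCycles.impossible k f f-injective f-adjacent matchless vs cycle disjoint 1≤k
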